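{- Let $A,B$ be thin groupoids, $T\in\mathbf{U}_{A\multimap B}$, and let $\mathbf{S}\subseteq\mathbf{T}_A$ be a class with $\mathbf{S}^{\perp_{\mathrm{th}}\perp_{\mathrm{th}}}=\mathbf{T}_A$. Then $T\in\mathbf{T}_{A\multimap B}$ if and only if $T@S\in\mathbf{T}_B$ for all $S\in\mathbf{S}$.
   Context: All groupoids are small. $\mathbf{Gpd}$ is the $2$-category of groupoids, functors and natural transformations. Prestrategies. A prestrategy on $A$ is $(S,\partial^S:S\to A)$; one from $A$ to $B$ is a prestrategy on $A\times B$, with $\partial^S=\langle\partial^S_A,\partial^S_B\rangle$. Bipullbacks. For a cospan $S\xrightarrow{u}B\xleftarrow{v}T$, a pseudocone with vertex $X$ is $(l',r',\nu:ul'\Rightarrow vr')$, and a morphism of pseudocones is $(\alpha:l'\Rightarrow l'',\beta:r'\Rightarrow r'')$ with $\nu''\circ u\alpha=v\beta\circ\nu$. $(P,l,r,\mu)$ is a bipullback if, for each $X$, $h\mapsto(lh,rh,\mu h)$ is an equivalence from $\mathbf{Gpd}(X,P)$ to pseudocones with vertex $X$. Commuting squares are pseudocones with identity $2$-cell. Uniform structure. $S\perp T$ iff the pullback of $S\to B\leftarrow T$ is a bipullback, and $\mathbf{S}^\perp=\{T\mid\forall S\in\mathbf{S},S\perp T\}$. A uniform groupoid is $(A,\mathbf{U}_A)$ with $\mathbf{U}_A^{\perp\perp}=\mathbf{U}_A$. Thin orthogonality. For $S\in\mathbf{U}_A$ and $T\in\mathbf{U}_A^\perp$, $S\perp_{\mathrm{th}}T$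 iff the pullback of $S\to A\leftarrow T$ is discrete (all morphisms identities). For $\mathbf{S}\subseteq\mathbf{U}_A$, $\mathbf{S}^{\perp_{\mathrm{th}}}=\{T\in\mathbf{U}_A^\perp\mid\forall S\in\mathbf{S},S\perp_{\mathrm{th}}T\}$; for $\mathbf{V}\subseteq\mathbf{U}_A^\perp$, $\mathbf{V}^{\perp_{\mathrm{th}}}=\{S\in\mathbf{U}_A\mid\forall T\in\mathbf{V},S\perp_{\mathrm{th}}T\}$. Thin groupoids. A thin groupoid is a groupoid $A$ with: - subgroupoids $A_-,A_+$ containing all objects, - a uniform structure $\mathbf{U}_A$, and - $\mathbf{T}_A\subseteq\mathbf{U}_A$ with $\mathbf{T}_A^{\perp_{\mathrm{th}}\perp_{\mathrm{th}}}=\mathbf{T}_A$, $(A_-,\mathrm{incl})\in\mathbf{T}_A$ and $(A_+,\mathrm{incl})\in\mathbf{T}_A^{\perp_{\mathrm{th}}}$. Linear arrow. For thin $A,B$, $A\multimap B$ has: - underlying groupoid $A\times B$; - $(A\multimap B)_-=A_+\times B_-$ and $(A\multimap B)_+=A_-\times B_+$; - $\mathbf{U}_{A\multimap B}=\{(S\times U,\partial^S\times\partial^U)\mid S\in\mathbf{U}_A,U\in\mathbf{U}_B^\perp\}^\perp$; - $\mathbf{T}_{A\multimap B}=\{T\in\mathbf{U}_{A\multimap B}\mid$ for all $S\in\mathbf{T}_A$ and $U\in\mathbf{T}_B^{\perp_{\mathrm{th}}}$, the pullback of $T\to A\times B\xleftarrow{\partial^S\times\partial^U}S\times U$ is discrete$\}$.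 Application. For $S$ on $A$ and $T$ from $A$ to $B$, $T@S$ is the pullback $P$ of $S\xrightarrow{\partial^S}A\xleftarrow{\partial^T_A}T$ with display $\partial^T_B\circ r$, where $r:P\to T$ is the projection. -}

module Defs where

open import Level using (Level; 0ℓ; suc)
open import Data.Product using (Σ; Σ-syntax; _×_; _,_; proj₁; proj₂)
open import Relation.Binary using (Rel; IsEquivalence; Setoid)
open import Relation.Binary.PropositionalEquality using (_≡_; refl)
import Relation.Binary.Reasoning.Setoid as SR

record Groupoid : Set₁ where
  infixr 9 _∘_
  infix  4 _≈_
  field
    Obj   : Set
    Hom   : Obj → Obj → Set
    _≈_   : ∀ {x y} → Rel (Hom x y) 0ℓ
    equiv : ∀ {x y} → IsEquivalence (_≈_ {x} {y})
    id    : ∀ {x} → Hom x x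
    _∘_   : ∀ {x y z} → Hom y z → Hom x y → Hom x z
    _⁻¹   : ∀ {x y} → Hom x y → Hom y x
    assoc : ∀ {w x y z} {f : Hom w x} {g : Hom x y} {h : Hom y z} →
            (h ∘ g) ∘ f ≈ h ∘ (g ∘ f)
    identityˡ : ∀ {x y} {f : Hom x y} → id ∘ f ≈ f
    identityʳ : ∀ {x y} {f : Hom x y} → f ∘ id ≈ f
    inverseˡ  : ∀ {x y} {f : Hom x y} → (f ⁻¹) ∘ f ≈ id
    inverseʳ  : ∀ {x y} {f : Hom x y} → f ∘ (f ⁻¹) ≈ id
    ∘-resp-≈  : ∀ {x y z} {f f' : Hom y z} {g g' : Hom x y} →
                f ≈ f' → g ≈ g' → f ∘ g ≈ f' ∘ g'

  hom-setoid : Obj → Obj → Setoid 0ℓ 0ℓ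
  hom-setoid x y = record { Carrier = Hom x y ; _≈_ = _≈_ ; isEquivalence = equiv }

  module E {x y} = IsEquivalence (equiv {x} {y})

  ⟦_⟧ : ∀ {x y} → x ≡ y → Hom x y
  ⟦ refl ⟧ = id

  IsIdentity : ∀ {x y} → Hom x y → Set
  IsIdentity {x} {y} f = Σ[ e ∈ x ≡ y ] (f ≈ ⟦ e ⟧)

  flip-sq : ∀ {p q r s} {a : Hom q s} {x : Hom p q} {y : Hom r s} {b : Hom p r} →
            a ∘ x ≈ y ∘ b → (a ⁻¹) ∘ y ≈ x ∘ (b ⁻¹)
  flip-sq {p} {q} {r} {s} {a} {x} {y} {b} sq = begin
      (a ⁻¹) ∘ y                   ≈⟨ ∘-resp-≈ E.refl (E.sym identityʳ) ⟩
      (a ⁻¹) ∘ (y ∘ id)            ≈⟨ ∘-resp-≈ E.refl (∘-resp-≈ E.refl (E.sym inverseʳ)) ⟩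
      (a ⁻¹) ∘ (y ∘ (b ∘ (b ⁻¹)))  ≈⟨ ∘-resp-≈ E.refl (E.sym assoc) ⟩
      (a ⁻¹) ∘ ((y ∘ b) ∘ (b ⁻¹))  ≈⟨ ∘-resp-≈ E.refl (∘-resp-≈ (E.sym sq) E.refl) ⟩
      (a ⁻¹) ∘ ((a ∘ x) ∘ (b ⁻¹))  ≈⟨ ∘-resp-≈ E.refl assoc ⟩
      (a ⁻¹) ∘ (a ∘ (x ∘ (b ⁻¹)))  ≈⟨ E.sym assoc ⟩
      ((a ⁻¹) ∘ a) ∘ (x ∘ (b ⁻¹))  ≈⟨ ∘-resp-≈ inverseˡ E.refl ⟩
      id ∘ (x ∘ (b ⁻¹))            ≈⟨ identityˡ ⟩
      x ∘ (b ⁻¹)                   ∎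
    where open SR (hom-setoid r q)

open Groupoid using (Obj; Hom)

record Functor (C D : Groupoid) : Set where
  private
    module C = Groupoid C
    module D = Groupoid D
  field
    F₀ : C.Obj → D.Obj
    F₁ : ∀ {x y} → C.Hom x y → D.Hom (F₀ x) (F₀ y)
    identity     : ∀ {x} → F₁ (C.id {x}) D.≈ D.id
    homomorphism : ∀ {x y z} {f : C.Hom x y} {g : C.Hom y z} →
                   F₁ (g C.∘ f) D.≈ F₁ g D.∘ F₁ f
    F-resp-≈     : ∀ {x y} {f g : C.Hom x y} → f C.≈ g → F₁ f D.≈ F₁ g

  F-inv : ∀ {x y} {f : C.Hom x y} → F₁ (f C.⁻¹) D.≈ (F₁ f) D.⁻¹
  F-inv {x} {y} {f} = begin
      F₁ (f C.⁻¹)                                 ≈⟨ D.E.sym D.identityʳ ⟩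
      F₁ (f C.⁻¹) D.∘ D.id                        ≈⟨ D.∘-resp-≈ D.E.refl (D.E.sym D.inverseʳ) ⟩
      F₁ (f C.⁻¹) D.∘ (F₁ f D.∘ (F₁ f D.⁻¹))      ≈⟨ D.E.sym D.assoc ⟩
      (F₁ (f C.⁻¹) D.∘ F₁ f) D.∘ (F₁ f D.⁻¹)      ≈⟨ D.∘-resp-≈ (D.E.sym homomorphism) D.E.refl ⟩
      F₁ ((f C.⁻¹) C.∘ f) D.∘ (F₁ f D.⁻¹)         ≈⟨ D.∘-resp-≈ (F-resp-≈ C.inverseˡ) D.E.refl ⟩
      F₁ C.id D.∘ (F₁ f D.⁻¹)                     ≈⟨ D.∘-resp-≈ identity D.E.refl ⟩
      D.id D.∘ (F₁ f D.⁻¹)                        ≈⟨ D.identityˡ ⟩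
      F₁ f D.⁻¹                                   ∎
    where open SR (D.hom-setoid (F₀ y) (F₀ x))

record NatTrans {C D : Groupoid} (F G : Functor C D) : Set where
  private
    module C = Groupoid C
    module D = Groupoid D
    module F = Functor F
    module G = Functor G
  field
    η       : ∀ x → D.Hom (F.F₀ x) (G.F₀ x)
    commute : ∀ {x y} (f : C.Hom x y) → η y D.∘ F.F₁ f D.≈ G.F₁ f D.∘ η x

open Functor using (F₀; F₁)
open NatTrans using (η)

infixr 9 _∘F_
_∘F_ : ∀ {A B C} → Functor B C → Functor A B → Functor A C
_∘F_ {A} {B} {C} G F = record
  { F₀ = λ x → F₀ G (F₀ F x)
  ; F₁ = λ f → F₁ G (F₁ F f)
  ; identity = C.E.trans (Functor.F-resp-≈ G (Functor.identity F)) (Functor.identity G)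
  ; homomorphism = C.E.trans (Functor.F-resp-≈ G (Functor.homomorphism F)) (Functor.homomorphism G)
  ; F-resp-≈ = λ e → Functor.F-resp-≈ G (Functor.F-resp-≈ F e)
  }
  where module C = Groupoid C

infixr 2 _⊗_
_⊗_ : Groupoid → Groupoid → Groupoid
A ⊗ B = record
  { Obj = Obj A × Obj B
  ; Hom = λ x y → Hom A (proj₁ x) (proj₁ y) × Hom B (proj₂ x) (proj₂ y)
  ; _≈_ = λ f g → (proj₁ f A.≈ proj₁ g) × (proj₂ f B.≈ proj₂ g)
  ; equiv = record
      { refl  = A.E.refl , B.E.refl
      ; sym   = λ e → A.E.sym (proj₁ e) , B.E.sym (proj₂ e)
      ; trans = λ e e' → A.E.trans (proj₁ e) (proj₁ e') , B.E.trans (proj₂ e) (proj₂ e') }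
  ; id = A.id , B.id
  ; _∘_ = λ g f → (proj₁ g A.∘ proj₁ f) , (proj₂ g B.∘ proj₂ f)
  ; _⁻¹ = λ f → (proj₁ f A.⁻¹) , (proj₂ f B.⁻¹)
  ; assoc = A.assoc , B.assoc
  ; identityˡ = A.identityˡ , B.identityˡ
  ; identityʳ = A.identityʳ , B.identityʳ
  ; inverseˡ = A.inverseˡ , B.inverseˡ
  ; inverseʳ = A.inverseʳ , B.inverseʳ
  ; ∘-resp-≈ = λ e e' → A.∘-resp-≈ (proj₁ e) (proj₁ e') , B.∘-resp-≈ (proj₂ e) (proj₂ e')
  }
  where
    module A = Groupoid A
    module B = Groupoid B

π₁ : ∀ {A B} → Functor (A ⊗ B) A
π₁ {A} {B} = record
  { F₀ = proj₁ ; F₁ = proj₁ ; identity = A.E.refl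
  ; homomorphism = A.E.refl ; F-resp-≈ = proj₁ }
  where module A = Groupoid A

π₂ : ∀ {A B} → Functor (A ⊗ B) B
π₂ {A} {B} = record
  { F₀ = proj₂ ; F₁ = proj₂ ; identity = B.E.refl
  ; homomorphism = B.E.refl ; F-resp-≈ = proj₂ }
  where module B = Groupoid B

_⊗F_ : ∀ {A B C D} → Functor A C → Functor B D → Functor (A ⊗ B) (C ⊗ D)
F ⊗F G = record
  { F₀ = λ x → F₀ F (proj₁ x) , F₀ G (proj₂ x)
  ; F₁ = λ f → F₁ F (proj₁ f) , F₁ G (proj₂ f)
  ; identity = Functor.identity F , Functor.identity G
  ; homomorphism = Functor.homomorphism F , Functor.homomorphism G
  ; F-resp-≈ = λ e → Functor.F-resp-≈ F (proj₁ e) , Functor.F-resp-≈ G (proj₂ e)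
  }

module Pullback {S T B : Groupoid} (u : Functor S B) (v : Functor T B) where
  private
    module S = Groupoid S
    module T = Groupoid T
    module B = Groupoid B
    module u = Functor u
    module v = Functor v

  record PObj : Set where
    constructor pobj
    field
      src : S.Obj
      tgt : T.Obj
      eq  : u.F₀ src ≡ v.F₀ tgt
  open PObj

  -- morphisms: pairs (f , g) with  u f = v g  (modulo the canonical isos)
  record PHom (x y : PObj) : Set where
    constructor phom
    field
      hS   : S.Hom (src x) (src y)
      hT   : T.Hom (tgt x) (tgt y)
      comm : v.F₁ hT B.∘ B.⟦ eq x ⟧ B.≈ B.⟦ eq y ⟧ B.∘ u.F₁ hS
  open PHom

  private
    comp : ∀ {x y z} → PHom y z → PHom x y → PHom x z
    comp {x} {y} {z} (phom f' g' c') (phom f g c) = phom (f' S.∘ f) (g' T.∘ g) pf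
      where
        open SR (B.hom-setoid (u.F₀ (src x)) (v.F₀ (tgt z)))
        pf = begin
          v.F₁ (g' T.∘ g) B.∘ B.⟦ eq x ⟧           ≈⟨ B.∘-resp-≈ v.homomorphism B.E.refl ⟩
          (v.F₁ g' B.∘ v.F₁ g) B.∘ B.⟦ eq x ⟧       ≈⟨ B.assoc ⟩
          v.F₁ g' B.∘ (v.F₁ g B.∘ B.⟦ eq x ⟧)       ≈⟨ B.∘-resp-≈ B.E.refl c ⟩
          v.F₁ g' B.∘ (B.⟦ eq y ⟧ B.∘ u.F₁ f)       ≈⟨ B.E.sym B.assoc ⟩
          (v.F₁ g' B.∘ B.⟦ eq y ⟧) B.∘ u.F₁ f       ≈⟨ B.∘-resp-≈ c' B.E.refl ⟩
          (B.⟦ eq z ⟧ B.∘ u.F₁ f') B.∘ u.F₁ f       ≈⟨ B.assoc ⟩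
          B.⟦ eq z ⟧ B.∘ (u.F₁ f' B.∘ u.F₁ f)       ≈⟨ B.∘-resp-≈ B.E.refl (B.E.sym u.homomorphism) ⟩
          B.⟦ eq z ⟧ B.∘ u.F₁ (f' S.∘ f)            ∎

    ident : ∀ {x} → PHom x x
    ident {x} = phom S.id T.id pf
      where
        open SR (B.hom-setoid (u.F₀ (src x)) (v.F₀ (tgt x)))
        pf = begin
          v.F₁ T.id B.∘ B.⟦ eq x ⟧    ≈⟨ B.∘-resp-≈ v.identity B.E.refl ⟩
          B.id B.∘ B.⟦ eq x ⟧         ≈⟨ B.identityˡ ⟩
          B.⟦ eq x ⟧                  ≈⟨ B.E.sym B.identityʳ ⟩
          B.⟦ eq x ⟧ B.∘ B.id         ≈⟨ B.∘-resp-≈ B.E.refl (B.E.sym u.identity) ⟩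
          B.⟦ eq x ⟧ B.∘ u.F₁ S.id    ∎

    inv : ∀ {x y} → PHom x y → PHom y x
    inv {x} {y} (phom f g c) = phom (f S.⁻¹) (g T.⁻¹) pf
      where
        open SR (B.hom-setoid (u.F₀ (src y)) (v.F₀ (tgt x)))
        pf = begin
          v.F₁ (g T.⁻¹) B.∘ B.⟦ eq y ⟧        ≈⟨ B.∘-resp-≈ v.F-inv B.E.refl ⟩
          (v.F₁ g B.⁻¹) B.∘ B.⟦ eq y ⟧        ≈⟨ B.flip-sq c ⟩
          B.⟦ eq x ⟧ B.∘ (u.F₁ f B.⁻¹)        ≈⟨ B.∘-resp-≈ B.E.refl (B.E.sym u.F-inv) ⟩
          B.⟦ eq x ⟧ B.∘ u.F₁ (f S.⁻¹)        ∎

  P : Groupoid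
  P = record
    { Obj = PObj
    ; Hom = PHom
    ; _≈_ = λ a b → (hS a S.≈ hS b) × (hT a T.≈ hT b)
    ; equiv = record
        { refl  = S.E.refl , T.E.refl
        ; sym   = λ e → S.E.sym (proj₁ e) , T.E.sym (proj₂ e)
        ; trans = λ e e' → S.E.trans (proj₁ e) (proj₁ e') , T.E.trans (proj₂ e) (proj₂ e') }
    ; id = ident
    ; _∘_ = comp
    ; _⁻¹ = inv
    ; assoc = S.assoc , T.assoc
    ; identityˡ = S.identityˡ , T.identityˡ
    ; identityʳ = S.identityʳ , T.identityʳ
    ; inverseˡ = S.inverseˡ , T.inverseˡ
    ; inverseʳ = S.inverseʳ , T.inverseʳ
    ; ∘-resp-≈ = λ e e' → S.∘-resp-≈ (proj₁ e) (proj₁ e') , T.∘-resp-≈ (proj₂ e) (proj₂ e')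
    }

  l : Functor P S
  l = record { F₀ = src ; F₁ = hS ; identity = S.E.refl
             ; homomorphism = S.E.refl ; F-resp-≈ = proj₁ }

  r : Functor P T
  r = record { F₀ = tgt ; F₁ = hT ; identity = T.E.refl
             ; homomorphism = T.E.refl ; F-resp-≈ = proj₂ }

  μ : NatTrans (u ∘F l) (v ∘F r)
  μ = record { η = λ x → B.⟦ eq x ⟧ ; commute = λ f → B.E.sym (comm f) }

  -- the pullback is discrete: every morphism is an identity
  -- (a morphism (f , g) of the pullback is an identity iff f and g are)
  Discrete : Set
  Discrete = ∀ {x y} (f : PHom x y) → S.IsIdentity (hS f) × T.IsIdentity (hT f)

module _ {S T B : Groupoid} (u : Functor S B) (v : Functor T B) where
  private
    module S = Groupoid S
    module T = Groupoid T
    module B = Groupoid B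

  -- (P , l , r , μ) is a bipullback: for every X, the functor
  --   Gpd(X,P) → PseudoCones(X),  h ↦ (l h , r h , μ h)
  -- is an equivalence, i.e. essentially surjective, full and faithful.
  record IsBipullback (P : Groupoid) (l : Functor P S) (r : Functor P T)
                      (μ : NatTrans (u ∘F l) (v ∘F r)) : Set₁ where
    private module P = Groupoid P
    field
      ess-surj :
        ∀ (X : Groupoid) (l' : Functor X S) (r' : Functor X T)
          (ν : NatTrans (u ∘F l') (v ∘F r')) →
        Σ[ h ∈ Functor X P ]
        Σ[ α ∈ NatTrans (l ∘F h) l' ]
        Σ[ β ∈ NatTrans (r ∘F h) r' ]
          (∀ x → η ν x B.∘ F₁ u (η α x) B.≈ F₁ v (η β x) B.∘ η μ (F₀ h x))
      full :
        ∀ (X : Groupoid) (h h' : Functor X P)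
          (α : NatTrans (l ∘F h) (l ∘F h')) (β : NatTrans (r ∘F h) (r ∘F h')) →
          (∀ x → η μ (F₀ h' x) B.∘ F₁ u (η α x) B.≈ F₁ v (η β x) B.∘ η μ (F₀ h x)) →
        Σ[ θ ∈ NatTrans h h' ]
          ((∀ x → F₁ l (η θ x) S.≈ η α x) × (∀ x → F₁ r (η θ x) T.≈ η β x))
      faithful :
        ∀ (X : Groupoid) (h h' : Functor X P) (θ θ' : NatTrans h h') →
          (∀ x → F₁ l (η θ x) S.≈ F₁ l (η θ' x)) →
          (∀ x → F₁ r (η θ x) T.≈ F₁ r (η θ' x)) →
          ∀ x → η θ x P.≈ η θ' x

record Prestrategy (A : Groupoid) : Set₁ where
  constructor prestrategy
  field
    carrier : Groupoid
    ∂       : Functor carrier A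
open Prestrategy public

Class : Groupoid → Set₂
Class A = Prestrategy A → Set₁

_⊆_ : ∀ {A} → Class A → Class A → Set₁
𝐒 ⊆ 𝐓 = ∀ S → 𝐒 S → 𝐓 S

_≐_ : ∀ {A} → Class A → Class A → Set₁
𝐒 ≐ 𝐓 = (𝐒 ⊆ 𝐓) × (𝐓 ⊆ 𝐒)

_⊥_ : ∀ {A} → Prestrategy A → Prestrategy A → Set₁
S ⊥ T = IsBipullback (∂ S) (∂ T) PB.P PB.l PB.r PB.μ
  where module PB = Pullback (∂ S) (∂ T)

_^⊥ : ∀ {A} → Class A → Class A
(𝐒 ^⊥) T = ∀ S → 𝐒 S → S ⊥ T

IsUniform : ∀ {A} → Class A → Set₁
IsUniform 𝐔 = ((𝐔 ^⊥) ^⊥) ≐ 𝐔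

_⊥th_ : ∀ {A} → Prestrategy A → Prestrategy A → Set
S ⊥th T = Pullback.Discrete (∂ S) (∂ T)

-- 𝐒^{⊥th} for 𝐒 ⊆ 𝐔  (a subclass of 𝐔^⊥)
thR : ∀ {A} → Class A → Class A → Class A
thR 𝐔 𝐒 T = (𝐔 ^⊥) T × (∀ S → 𝐒 S → S ⊥th T)

-- 𝐕^{⊥th} for 𝐕 ⊆ 𝐔^⊥  (a subclass of 𝐔)
thL : ∀ {A} → Class A → Class A → Class A
thL 𝐔 𝐕 S = 𝐔 S × (∀ T → 𝐕 T → S ⊥th T)

record WideSub (A : Groupoid) : Set₁ where
  private module A = Groupoid A
  field
    mem      : ∀ {x y} → A.Hom x y → Set
    mem-resp : ∀ {x y} {f g : A.Hom x y} → f A.≈ g → mem f → mem g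
    mem-id   : ∀ {x} → mem (A.id {x})
    mem-∘    : ∀ {x y z} {f : A.Hom x y} {g : A.Hom y z} → mem g → mem f → mem (g A.∘ f)
    mem-⁻¹   : ∀ {x y} {f : A.Hom x y} → mem f → mem (f A.⁻¹)

subPre : ∀ {A} → WideSub A → Prestrategy A
subPre {A} W = prestrategy G incl
  where
    module A = Groupoid A
    open WideSub W
    G : Groupoid
    G = record
      { Obj = A.Obj
      ; Hom = λ x y → Σ[ f ∈ A.Hom x y ] mem f
      ; _≈_ = λ f g → proj₁ f A.≈ proj₁ g
      ; equiv = record { refl = A.E.refl ; sym = A.E.sym ; trans = A.E.trans }
      ; id = A.id , mem-id
      ; _∘_ = λ g f → (proj₁ g A.∘ proj₁ f) , mem-∘ (proj₂ g) (proj₂ f)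
      ; _⁻¹ = λ f → (proj₁ f A.⁻¹) , mem-⁻¹ (proj₂ f)
      ; assoc = A.assoc ; identityˡ = A.identityˡ ; identityʳ = A.identityʳ
      ; inverseˡ = A.inverseˡ ; inverseʳ = A.inverseʳ ; ∘-resp-≈ = A.∘-resp-≈ }
    incl : Functor G A
    incl = record { F₀ = λ x → x ; F₁ = proj₁ ; identity = A.E.refl
                  ; homomorphism = A.E.refl ; F-resp-≈ = λ e → e }

record ThinGroupoid : Set₂ where
  field
    G       : Groupoid
    neg pos : WideSub G
    𝐔       : Class G
    uniform : IsUniform 𝐔
    𝐓       : Class G
    𝐓⊆𝐔     : 𝐓 ⊆ 𝐔
    𝐓-closed : thL 𝐔 (thR 𝐔 𝐓) ≐ 𝐓
    neg∈𝐓   : 𝐓 (subPre neg)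
    pos∈𝐓⊥  : thR 𝐔 𝐓 (subPre pos)

_⊠_ : ∀ {A B} → Prestrategy A → Prestrategy B → Prestrategy (A ⊗ B)
S ⊠ U = prestrategy (carrier S ⊗ carrier U) (∂ S ⊗F ∂ U)

module _ (A B : ThinGroupoid) where
  private
    module A = ThinGroupoid A
    module B = ThinGroupoid B

  -- 𝐔_{A ⊸ B} = { S × U | S ∈ 𝐔_A , U ∈ 𝐔_B^⊥ }^⊥
  𝐔⊸ : Class (A.G ⊗ B.G)
  𝐔⊸ T = ∀ S U → A.𝐔 S → (B.𝐔 ^⊥) U → (S ⊠ U) ⊥ T

  𝐓⊸ : Class (A.G ⊗ B.G)
  𝐓⊸ T = 𝐔⊸ T × (∀ S U → A.𝐓 S → thR B.𝐔 B.𝐓 U →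
                   Pullback.Discrete (∂ T) (∂ (S ⊠ U)))

_＠_ : ∀ {A B} → Prestrategy (A ⊗ B) → Prestrategy A → Prestrategy B
T ＠ S = prestrategy PB.P (π₂ ∘F (∂ T ∘F PB.r))
  where module PB = Pullback (∂ S) (π₁ ∘F ∂ T)

{-# OPTIONS --safe #-}
module Submission where

-- Bipullback orthogonality of a strict pullback of groupoids is a lifting property: every
-- isomorphism between images of the two legs is isomorphic to one coming from the pullback.
-- The pullbacks of T against S ⊠ U, of T ＠ S against U and of S against T ᵀ＠ U all consist of
-- triples (s, t, u) matching over A and over B, bracketed differently; so lifts for the first
-- give lifts for the other two, and discreteness passes around the three.  Thus T ＠ S ∈ 𝐓_B for
-- every S ∈ 𝐓_A when T ∈ 𝐓_{A⊸B}.  Conversely, if T ＠ S ∈ 𝐓_B for all S ∈ 𝐒, then for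
-- U ∈ 𝐓_B^⊥th the prestrategy T ᵀ＠ U lies in 𝐒^⊥th, hence is thinly orthogonal to every
-- S ∈ 𝐓_A = 𝐒^⊥th⊥th, which is the discreteness demanded by 𝐓_{A⊸B}.

open import Defs
open import Function.Bundles using (_⇔_; mk⇔)
open import Data.Unit using (⊤; tt)
open import Data.Product using (Σ-syntax; _×_; _,_; proj₁; proj₂)
open import Relation.Binary.PropositionalEquality using (_≡_; refl; sym; cong; cong₂)
open import Axiom.UniquenessOfIdentityProofs.WithK using (uip)
import Relation.Binary.Reasoning.Setoid as SetoidReasoning
open Functor using (F₀; F₁)
open NatTrans using (η)

module GroupoidProperties (C : Groupoid) where
  open Groupoid C

  cancelˡ : ∀ {x y z} {a : Hom y z} {g : Hom x z} → a ∘ (a ⁻¹ ∘ g) ≈ g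
  cancelˡ = E.trans (E.sym assoc) (E.trans (∘-resp-≈ inverseʳ E.refl) identityˡ)

  cancelʳ : ∀ {x y z} {w : Hom x y} {g : Hom y z} → (g ∘ w) ∘ w ⁻¹ ≈ g
  cancelʳ = E.trans assoc (E.trans (∘-resp-≈ E.refl inverseʳ) identityʳ)

  id⁻¹≈id : ∀ {x} → id {x} ⁻¹ ≈ id
  id⁻¹≈id = E.trans (E.sym identityˡ) inverseʳ

  ⁻¹-sq⇒sq : ∀ {p q r s} {x : Hom q s} {y : Hom p s} {z : Hom r q} {w : Hom p r} →
             x ⁻¹ ∘ y ≈ z ∘ w → x ∘ z ≈ y ∘ w ⁻¹
  ⁻¹-sq⇒sq {x = x} {y} {z} {w} sq = begin
    x ∘ z                  ≈⟨ E.sym cancelʳ ⟩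
    ((x ∘ z) ∘ w) ∘ w ⁻¹   ≈⟨ ∘-resp-≈ assoc E.refl ⟩
    (x ∘ (z ∘ w)) ∘ w ⁻¹   ≈⟨ ∘-resp-≈ (∘-resp-≈ E.refl (E.sym sq)) E.refl ⟩
    (x ∘ (x ⁻¹ ∘ y)) ∘ w ⁻¹ ≈⟨ ∘-resp-≈ cancelˡ E.refl ⟩
    y ∘ w ⁻¹               ∎
    where open SetoidReasoning (hom-setoid _ _)

  ⟦sym⟧≈⟦⟧⁻¹ : ∀ {x y} (e : x ≡ y) → ⟦ sym e ⟧ ≈ ⟦ e ⟧ ⁻¹
  ⟦sym⟧≈⟦⟧⁻¹ refl = E.sym id⁻¹≈id

  ⁻¹-sq⇒⟦sym⟧-sq : ∀ {p q r s} {x : Hom q s} {y : Hom p s} {z : Hom r q} (e : p ≡ r) →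
                   x ⁻¹ ∘ y ≈ z ∘ ⟦ e ⟧ → x ∘ z ≈ y ∘ ⟦ sym e ⟧
  ⁻¹-sq⇒⟦sym⟧-sq e sq = E.trans (⁻¹-sq⇒sq sq) (∘-resp-≈ E.refl (E.sym (⟦sym⟧≈⟦⟧⁻¹ e)))

  ⟦⟧-sq-sym : ∀ {x x' y y'} {f : Hom x y} {g : Hom x' y'} (e : x ≡ x') (e' : y ≡ y') →
              g ∘ ⟦ e ⟧ ≈ ⟦ e' ⟧ ∘ f → f ∘ ⟦ sym e ⟧ ≈ ⟦ sym e' ⟧ ∘ g
  ⟦⟧-sq-sym refl refl sq = E.trans identityʳ (E.trans (E.sym identityˡ)
                             (E.trans (E.sym sq) (E.trans identityʳ (E.sym identityˡ))))

  conjugate : ∀ {x x' y y'} → Hom x' x → Hom x y → Hom y' y → Hom x' y'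
  conjugate a f b = b ⁻¹ ∘ (f ∘ a)

  conjugate-id : ∀ {x y} {a : Hom x y} {i : Hom y y} → i ≈ id → conjugate a i a ≈ id
  conjugate-id i≈id = E.trans (∘-resp-≈ E.refl (E.trans (∘-resp-≈ i≈id E.refl) identityˡ)) inverseˡ

  conjugate-∘ : ∀ {x y z x' y' z'} {a : Hom x' x} {b : Hom y' y} {c : Hom z' z}
                  {f : Hom x y} {g : Hom y z} →
                conjugate a (g ∘ f) c ≈ conjugate b g c ∘ conjugate a f b
  conjugate-∘ {a = a} {b} {c} {f} {g} = begin
    c ⁻¹ ∘ ((g ∘ f) ∘ a)               ≈⟨ ∘-resp-≈ E.refl assoc ⟩
    c ⁻¹ ∘ (g ∘ (f ∘ a))               ≈⟨ ∘-resp-≈ E.refl (∘-resp-≈ E.refl (E.sym cancelˡ)) ⟩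
    c ⁻¹ ∘ (g ∘ (b ∘ (b ⁻¹ ∘ (f ∘ a)))) ≈⟨ ∘-resp-≈ E.refl (E.sym assoc) ⟩
    c ⁻¹ ∘ ((g ∘ b) ∘ (b ⁻¹ ∘ (f ∘ a))) ≈⟨ E.sym assoc ⟩
    (c ⁻¹ ∘ (g ∘ b)) ∘ (b ⁻¹ ∘ (f ∘ a)) ∎
    where open SetoidReasoning (hom-setoid _ _)

  conjugate-resp-≈ : ∀ {x x' y y'} {a : Hom x' x} {f g : Hom x y} {b : Hom y' y} →
                     f ≈ g → conjugate a f b ≈ conjugate a g b
  conjugate-resp-≈ f≈g = ∘-resp-≈ E.refl (∘-resp-≈ f≈g E.refl)

  conjugate-square : ∀ {x₁ x₂ y₁ y₂ x₁' x₂' y₁' y₂'}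
      {ax : Hom x₁' x₁} {ay : Hom y₁' y₁} {f : Hom x₁ y₁}
      {bx : Hom x₂' x₂} {by : Hom y₂' y₂} {g : Hom x₂ y₂}
      {nx : Hom x₁ x₂} {ny : Hom y₁ y₂} {ex : Hom x₁' x₂'} {ey : Hom y₁' y₂'} →
      nx ∘ ax ≈ bx ∘ ex → ny ∘ ay ≈ by ∘ ey → ny ∘ f ≈ g ∘ nx →
      conjugate bx g by ∘ ex ≈ ey ∘ conjugate ax f ay
  conjugate-square {ax = ax} {ay} {f} {bx} {by} {g} {nx} {ny} {ex} {ey} sqx sqy nat = begin
    (by ⁻¹ ∘ (g ∘ bx)) ∘ ex   ≈⟨ assoc ⟩
    by ⁻¹ ∘ ((g ∘ bx) ∘ ex)   ≈⟨ ∘-resp-≈ E.refl (E.trans assoc (∘-resp-≈ E.refl (E.sym sqx))) ⟩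
    by ⁻¹ ∘ (g ∘ (nx ∘ ax))   ≈⟨ ∘-resp-≈ E.refl (E.trans (E.sym assoc) (∘-resp-≈ (E.sym nat) E.refl)) ⟩
    by ⁻¹ ∘ ((ny ∘ f) ∘ ax)   ≈⟨ ∘-resp-≈ E.refl assoc ⟩
    by ⁻¹ ∘ (ny ∘ (f ∘ ax))   ≈⟨ E.sym assoc ⟩
    (by ⁻¹ ∘ ny) ∘ (f ∘ ax)   ≈⟨ ∘-resp-≈ (flip-sq (E.sym sqy)) E.refl ⟩
    (ey ∘ ay ⁻¹) ∘ (f ∘ ax)   ≈⟨ assoc ⟩
    ey ∘ (ay ⁻¹ ∘ (f ∘ ax))   ∎
    where open SetoidReasoning (hom-setoid _ _)

module _ {C D : Groupoid} (F : Functor C D) where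
  private
    module C = Groupoid C
    module D = Groupoid D
    module F = Functor F
  open GroupoidProperties using (conjugate)

  F₁-conjugate : ∀ {x x' y y'} {a : C.Hom x' x} {f : C.Hom x y} {b : C.Hom y' y} →
                 F.F₁ (conjugate C a f b) D.≈ conjugate D (F.F₁ a) (F.F₁ f) (F.F₁ b)
  F₁-conjugate = D.E.trans F.homomorphism (D.∘-resp-≈ F.F-inv F.homomorphism)

module ProductProperties (C D : Groupoid) where
  private
    module C = Groupoid C
    module D = Groupoid D
    module C⊗D = Groupoid (C ⊗ D)

  ⊗-∘⟦⟧⁻ : ∀ {x y z} {f : C⊗D.Hom x z} {g : C⊗D.Hom y z} (e : x ≡ y) →
            f C⊗D.≈ g C⊗D.∘ C⊗D.⟦ e ⟧ →
            (proj₁ f C.≈ proj₁ g C.∘ C.⟦ cong proj₁ e ⟧) × (proj₂ f D.≈ proj₂ g D.∘ D.⟦ cong proj₂ e ⟧)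
  ⊗-∘⟦⟧⁻ refl sq = sq

  ⊗-⟦⟧-square⁻ : ∀ {x x' y y'} {f : C⊗D.Hom x' y'} {g : C⊗D.Hom x y} (e : x ≡ x') (e' : y ≡ y') →
                 f C⊗D.∘ C⊗D.⟦ e ⟧ C⊗D.≈ C⊗D.⟦ e' ⟧ C⊗D.∘ g →
                 (proj₁ f C.∘ C.⟦ cong proj₁ e ⟧ C.≈ C.⟦ cong proj₁ e' ⟧ C.∘ proj₁ g) ×
                 (proj₂ f D.∘ D.⟦ cong proj₂ e ⟧ D.≈ D.⟦ cong proj₂ e' ⟧ D.∘ proj₂ g)
  ⊗-⟦⟧-square⁻ refl refl sq = sq

  ⊗-⟦⟧-square⁺ : ∀ {x₁ x₁' y₁ y₁' x₂ x₂' y₂ y₂'}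
                   {f₁ : C.Hom x₁' y₁'} {g₁ : C.Hom x₁ y₁} {f₂ : D.Hom x₂' y₂'} {g₂ : D.Hom x₂ y₂}
                   (e₁ : x₁ ≡ x₁') (e₁' : y₁ ≡ y₁') (e₂ : x₂ ≡ x₂') (e₂' : y₂ ≡ y₂') →
                 f₁ C.∘ C.⟦ e₁ ⟧ C.≈ C.⟦ e₁' ⟧ C.∘ g₁ → f₂ D.∘ D.⟦ e₂ ⟧ D.≈ D.⟦ e₂' ⟧ D.∘ g₂ →
                 (f₁ , f₂) C⊗D.∘ C⊗D.⟦ cong₂ _,_ e₁ e₂ ⟧ C⊗D.≈ C⊗D.⟦ cong₂ _,_ e₁' e₂' ⟧ C⊗D.∘ (g₁ , g₂)
  ⊗-⟦⟧-square⁺ refl refl refl refl sq₁ sq₂ = sq₁ , sq₂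

  IsIdentity-⊗⁺ : ∀ {x y} {f : C⊗D.Hom x y} →
                  C.IsIdentity (proj₁ f) → D.IsIdentity (proj₂ f) → C⊗D.IsIdentity f
  IsIdentity-⊗⁺ (refl , p) (refl , q) = refl , (p , q)

  IsIdentity-⊗⁻ : ∀ {x y} {f : C⊗D.Hom x y} →
                  C⊗D.IsIdentity f → C.IsIdentity (proj₁ f) × D.IsIdentity (proj₂ f)
  IsIdentity-⊗⁻ (refl , (p , q)) = (refl , p) , (refl , q)

𝟙 : Groupoid
𝟙 = record
  { Obj = ⊤ ; Hom = λ _ _ → ⊤ ; _≈_ = λ _ _ → ⊤
  ; equiv = record { refl = tt ; sym = λ _ → tt ; trans = λ _ _ → tt }
  ; id = tt ; _∘_ = λ _ _ → tt ; _⁻¹ = λ _ → tt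
  ; assoc = tt ; identityˡ = tt ; identityʳ = tt ; inverseˡ = tt ; inverseʳ = tt
  ; ∘-resp-≈ = λ _ _ → tt }

constF : ∀ {C : Groupoid} → Groupoid.Obj C → Functor 𝟙 C
constF {C} c = record
  { F₀ = λ _ → c ; F₁ = λ _ → C.id ; identity = C.E.refl
  ; homomorphism = C.E.sym C.identityˡ ; F-resp-≈ = λ _ → C.E.refl }
  where module C = Groupoid C

module PullbackProperties {S T B : Groupoid} (u : Functor S B) (v : Functor T B) where
  private
    module S = Groupoid S
    module T = Groupoid T
    module B = Groupoid B
    module u = Functor u
    module v = Functor v
  open Pullback u v
  open PObj
  open PHom
  open GroupoidProperties B using (conjugate; conjugate-square)

  record Lift (s : S.Obj) (t : T.Obj) (φ : B.Hom (u.F₀ s) (v.F₀ t)) : Set where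
    constructor lift
    field
      point  : PObj
      isoˢ   : S.Hom (src point) s
      isoᵗ   : T.Hom (tgt point) t
      square : φ B.∘ u.F₁ isoˢ B.≈ v.F₁ isoᵗ B.∘ B.⟦ eq point ⟧

  HasLifts : Set
  HasLifts = ∀ s t φ → Lift s t φ

  isBipullback⇒hasLifts : IsBipullback u v P l r μ → HasLifts
  isBipullback⇒hasLifts bp s t φ with IsBipullback.ess-surj bp 𝟙 (constF s) (constF t) ν
    where
      ν : NatTrans (u ∘F constF s) (v ∘F constF t)
      ν = record { η = λ _ → φ
                 ; commute = λ _ → B.E.trans (B.∘-resp-≈ B.E.refl u.identity)
                     (B.E.trans B.identityʳ (B.E.trans (B.E.sym B.identityˡ)
                        (B.∘-resp-≈ (B.E.sym v.identity) B.E.refl))) }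
  ... | h , α , β , sq = lift (F₀ h tt) (η α tt) (η β tt) (sq tt)

  -- Fullness and faithfulness hold for every strict pullback of groupoids.  For essential
  -- surjectivity, the lifts of the components of a pseudocone assemble into a functor because
  -- conjugation by the lifting isomorphisms preserves commuting squares.
  hasLifts⇒isBipullback : HasLifts → IsBipullback u v P l r μ
  hasLifts⇒isBipullback L = record
    { ess-surj = ess-surj
    ; full     = λ X h h' α β sq →
        record { η = λ x → phom (η α x) (η β x) (B.E.sym (sq x))
               ; commute = λ f → NatTrans.commute α f , NatTrans.commute β f }
        , (λ _ → S.E.refl) , (λ _ → T.E.refl)
    ; faithful = λ X h h' θ θ' eqˢ eqᵗ x → eqˢ x , eqᵗ x
    }
    where
      ess-surj : ∀ (X : Groupoid) (l' : Functor X S) (r' : Functor X T)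
                   (ν : NatTrans (u ∘F l') (v ∘F r')) →
                 Σ[ h ∈ Functor X P ] Σ[ α ∈ NatTrans (l ∘F h) l' ] Σ[ β ∈ NatTrans (r ∘F h) r' ]
                   (∀ x → η ν x B.∘ u.F₁ (η α x) B.≈ v.F₁ (η β x) B.∘ η μ (F₀ h x))
      ess-surj X l' r' ν = h , α , β , λ x → Lift.square (lifted x)
        where
          module X = Groupoid X
          module l' = Functor l'
          module r' = Functor r'
          module GS = GroupoidProperties S
          module GT = GroupoidProperties T

          lifted : ∀ x → Lift (l'.F₀ x) (r'.F₀ x) (η ν x)
          lifted x = L (l'.F₀ x) (r'.F₀ x) (η ν x)
          open module lifted x = Lift (lifted x) using (point; isoˢ; isoᵗ; square)

          hom : ∀ {x y} → X.Hom x y → PHom (point x) (point y)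
          hom {x} {y} f = phom (GS.conjugate (isoˢ x) (l'.F₁ f) (isoˢ y))
                               (GT.conjugate (isoᵗ x) (r'.F₁ f) (isoᵗ y))
            (B.E.trans (B.∘-resp-≈ (F₁-conjugate v) B.E.refl)
              (B.E.trans (conjugate-square (square x) (square y) (NatTrans.commute ν f))
                (B.∘-resp-≈ B.E.refl (B.E.sym (F₁-conjugate u)))))

          h : Functor X P
          h = record
            { F₀ = point ; F₁ = hom
            ; identity = GS.conjugate-id l'.identity , GT.conjugate-id r'.identity
            ; homomorphism = S.E.trans (GS.conjugate-resp-≈ l'.homomorphism) GS.conjugate-∘
                           , T.E.trans (GT.conjugate-resp-≈ r'.homomorphism) GT.conjugate-∘
            ; F-resp-≈ = λ e → GS.conjugate-resp-≈ (l'.F-resp-≈ e) , GT.conjugate-resp-≈ (r'.F-resp-≈ e) }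

          α : NatTrans (l ∘F h) l'
          α = record { η = isoˢ ; commute = λ _ → GS.cancelˡ }

          β : NatTrans (r ∘F h) r'
          β = record { η = isoᵗ ; commute = λ _ → GT.cancelˡ }

  IsIdentity-P⁺ : ∀ {x y} (f : PHom x y) →
                  S.IsIdentity (hS f) → T.IsIdentity (hT f) → Groupoid.IsIdentity P f
  IsIdentity-P⁺ {pobj s t e} {pobj .s .t e'} f (refl , p) (refl , q) with uip e e'
  ... | refl = refl , (p , q)

  IsIdentity-P⁻ : ∀ {x y} (f : PHom x y) →
                  Groupoid.IsIdentity P f → S.IsIdentity (hS f) × T.IsIdentity (hT f)
  IsIdentity-P⁻ f (refl , (p , q)) = (refl , p) , (refl , q)

open PullbackProperties using (lift; HasLifts; isBipullback⇒hasLifts; hasLifts⇒isBipullback)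

module _ {S T B : Groupoid} (u : Functor S B) (v : Functor T B) where
  open Groupoid B using (_⁻¹)
  open GroupoidProperties B using (⁻¹-sq⇒⟦sym⟧-sq)

  hasLifts-swap : HasLifts u v → HasLifts v u
  hasLifts-swap L t s φ with L s t (φ ⁻¹)
  ... | lift (Pullback.pobj s' t' e) a b sq = lift (Pullback.pobj t' s' (sym e)) b a (⁻¹-sq⇒⟦sym⟧-sq e sq)

⊥-sym : ∀ {A} {S T : Prestrategy A} → S ⊥ T → T ⊥ S
⊥-sym {S = S} {T} S⊥T =
  hasLifts⇒isBipullback (∂ T) (∂ S) (hasLifts-swap (∂ S) (∂ T) (isBipullback⇒hasLifts (∂ S) (∂ T) S⊥T))

-- T, read as a prestrategy from B to A, applied to U.
_ᵀ＠_ : ∀ {A B} → Prestrategy (A ⊗ B) → Prestrategy B → Prestrategy A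
T ᵀ＠ U = prestrategy PB.P (π₁ ∘F (∂ T ∘F PB.l))
  where module PB = Pullback (π₂ ∘F ∂ T) (∂ U)

module Application {A B : Groupoid} (T : Prestrategy (A ⊗ B)) (S : Prestrategy A) (U : Prestrategy B) where
  private
    module A = Groupoid A
    module B = Groupoid B
    module GA = GroupoidProperties A
    module GB = GroupoidProperties B
    module ST = Pullback (∂ S) (π₁ ∘F ∂ T)
    module TU = Pullback (π₂ ∘F ∂ T) (∂ U)
    module SU-T = Pullback (∂ (S ⊠ U)) (∂ T)
    module T-SU = Pullback (∂ T) (∂ (S ⊠ U))
    module ST-U = Pullback (∂ (T ＠ S)) (∂ U)
    module S-TU = Pullback (∂ S) (∂ (T ᵀ＠ U))
    open ProductProperties A B using (⊗-∘⟦⟧⁻; ⊗-⟦⟧-square⁻; ⊗-⟦⟧-square⁺)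
    open ProductProperties (carrier S) (carrier U) using (IsIdentity-⊗⁺; IsIdentity-⊗⁻)
    module STP = PullbackProperties (∂ S) (π₁ ∘F ∂ T)
    module TUP = PullbackProperties (π₂ ∘F ∂ T) (∂ U)

  hasLifts-＠ : HasLifts (∂ (S ⊠ U)) (∂ T) → HasLifts (∂ (T ＠ S)) (∂ U)
  hasLifts-＠ L (ST.pobj s t e₁) u φ with L (s , u) t (A.⟦ e₁ ⟧ , φ B.⁻¹)
  ... | lift (SU-T.pobj (s' , u') t' e) (as , au) bt sq with ⊗-∘⟦⟧⁻ e sq
  ...   | sqA , sqB =
    lift (ST-U.pobj (ST.pobj s' t' (cong proj₁ e)) u' (sym (cong proj₂ e)))
         (ST.phom as bt (A.E.sym sqA)) au (GB.⁻¹-sq⇒⟦sym⟧-sq (cong proj₂ e) sqB)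

  hasLifts-ᵀ＠ : HasLifts (∂ (S ⊠ U)) (∂ T) → HasLifts (∂ S) (∂ (T ᵀ＠ U))
  hasLifts-ᵀ＠ L s (TU.pobj t u e₂) φ with L (s , u) t (φ , B.⟦ e₂ ⟧ B.⁻¹)
  ... | lift (SU-T.pobj (s' , u') t' e) (as , au) bt sq with ⊗-∘⟦⟧⁻ e sq
  ...   | sqA , sqB =
    lift (S-TU.pobj s' (TU.pobj t' u' (sym (cong proj₂ e))) (cong proj₁ e))
         as (TU.phom bt au (B.E.sym (GB.⁻¹-sq⇒⟦sym⟧-sq (cong proj₂ e) sqB))) sqA

  ⊠⊥⇒⊥＠ : (S ⊠ U) ⊥ T → U ⊥ (T ＠ S)
  ⊠⊥⇒⊥＠ S⊠U⊥T = ⊥-sym (hasLifts⇒isBipullback (∂ (T ＠ S)) (∂ U)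
                     (hasLifts-＠ (isBipullback⇒hasLifts (∂ (S ⊠ U)) (∂ T) S⊠U⊥T)))

  ⊠⊥⇒⊥ᵀ＠ : (S ⊠ U) ⊥ T → S ⊥ (T ᵀ＠ U)
  ⊠⊥⇒⊥ᵀ＠ S⊠U⊥T = hasLifts⇒isBipullback (∂ S) (∂ (T ᵀ＠ U))
                     (hasLifts-ᵀ＠ (isBipullback⇒hasLifts (∂ (S ⊠ U)) (∂ T) S⊠U⊥T))

  ⊠⊥th⇒＠⊥th : T ⊥th (S ⊠ U) → (T ＠ S) ⊥th U
  ⊠⊥th⇒＠⊥th D {ST-U.pobj (ST.pobj s t e₁) u e₂} {ST-U.pobj (ST.pobj s' t' e₁') u' e₂'}
               (ST-U.phom (ST.phom fs ft sqA) fu sqB)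
    with D {T-SU.pobj t (s , u) (cong₂ _,_ (sym e₁) e₂)} {T-SU.pobj t' (s' , u') (cong₂ _,_ (sym e₁') e₂')}
           (T-SU.phom ft (fs , fu) (⊗-⟦⟧-square⁺ (sym e₁) (sym e₁') e₂ e₂' (GA.⟦⟧-sq-sym e₁ e₁' sqA) sqB))
  ... | idt , idsu with IsIdentity-⊗⁻ idsu
  ...   | ids , idu = STP.IsIdentity-P⁺ (ST.phom fs ft sqA) ids idt , idu

  ＠⊥th⇒⊥thᵀ＠ : (T ＠ S) ⊥th U → S ⊥th (T ᵀ＠ U)
  ＠⊥th⇒⊥thᵀ＠ D {S-TU.pobj s (TU.pobj t u e₂) e₁} {S-TU.pobj s' (TU.pobj t' u' e₂') e₁'}
               (S-TU.phom fs (TU.phom ft fu sqB) sqA)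
    with D {ST-U.pobj (ST.pobj s t e₁) u e₂} {ST-U.pobj (ST.pobj s' t' e₁') u' e₂'}
           (ST-U.phom (ST.phom fs ft sqA) fu sqB)
  ... | idst , idu with STP.IsIdentity-P⁻ (ST.phom fs ft sqA) idst
  ...   | ids , idt = ids , TUP.IsIdentity-P⁺ (TU.phom ft fu sqB) idt idu

  ⊥thᵀ＠⇒⊠⊥th : S ⊥th (T ᵀ＠ U) → T ⊥th (S ⊠ U)
  ⊥thᵀ＠⇒⊠⊥th D {T-SU.pobj t (s , u) e} {T-SU.pobj t' (s' , u') e'} (T-SU.phom ft (fs , fu) sq)
    with ⊗-⟦⟧-square⁻ e e' sq
  ... | sqA , sqB
    with D {S-TU.pobj s (TU.pobj t u (cong proj₂ e)) (sym (cong proj₁ e))}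
           {S-TU.pobj s' (TU.pobj t' u' (cong proj₂ e')) (sym (cong proj₁ e'))}
           (S-TU.phom fs (TU.phom ft fu sqB) (GA.⟦⟧-sq-sym (cong proj₁ e) (cong proj₁ e') sqA))
  ...   | ids , idtu with TUP.IsIdentity-P⁻ (TU.phom ft fu sqB) idtu
  ...     | idt , idu = idt , IsIdentity-⊗⁺ ids idu

module _ (A B : ThinGroupoid) (T : Prestrategy (ThinGroupoid.G A ⊗ ThinGroupoid.G B)) where
  private
    module A = ThinGroupoid A
    module B = ThinGroupoid B
  open Application T

  ＠-∈𝐓 : 𝐓⊸ A B T → ∀ S → A.𝐓 S → B.𝐓 (T ＠ S)
  ＠-∈𝐓 (T∈𝐔 , T⊥th⊠) S S∈𝐓 = proj₁ B.𝐓-closed (T ＠ S)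
    ( proj₁ B.uniform (T ＠ S) (λ U U∈𝐔⊥ → ⊠⊥⇒⊥＠ S U (T∈𝐔 S U (A.𝐓⊆𝐔 S S∈𝐓) U∈𝐔⊥))
    , λ U U∈𝐓⊥ → ⊠⊥th⇒＠⊥th S U (T⊥th⊠ S U S∈𝐓 U∈𝐓⊥) )

  ᵀ＠-∈⊥th : 𝐔⊸ A B T → (𝐒 : Class A.G) → (∀ S → 𝐒 S → B.𝐓 (T ＠ S)) →
             ∀ U → thR B.𝐔 B.𝐓 U → thR A.𝐔 𝐒 (T ᵀ＠ U)
  ᵀ＠-∈⊥th T∈𝐔 𝐒 T＠𝐒⊆𝐓 U (U∈𝐔⊥ , U∈𝐓⊥) =
      (λ S S∈𝐔 → ⊠⊥⇒⊥ᵀ＠ S U (T∈𝐔 S U S∈𝐔 U∈𝐔⊥))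
    , λ S S∈𝐒 → ＠⊥th⇒⊥thᵀ＠ S U (proj₂ (proj₂ B.𝐓-closed (T ＠ S) (T＠𝐒⊆𝐓 S S∈𝐒)) U (U∈𝐔⊥ , U∈𝐓⊥))

proposition2 : (A B : ThinGroupoid) →
    let module A = ThinGroupoid A
        module B = ThinGroupoid B
    in (T : Prestrategy (A.G ⊗ B.G)) → 𝐔⊸ A B T →
       (𝐒 : Class A.G) → 𝐒 ⊆ A.𝐓 → thL A.𝐔 (thR A.𝐔 𝐒) ≐ A.𝐓 →
       𝐓⊸ A B T ⇔ (∀ S → 𝐒 S → B.𝐓 (T ＠ S))
proposition2 A B T T∈𝐔 𝐒 𝐒⊆𝐓 (_ , 𝐓⊆𝐒⊥th⊥th) = mk⇔
  (λ T∈𝐓 S S∈𝐒 → ＠-∈𝐓 A B T T∈𝐓 S (𝐒⊆𝐓 S S∈𝐒))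
  (λ T＠𝐒⊆𝐓 → T∈𝐔 , λ S U S∈𝐓 U∈𝐓⊥ → Application.⊥thᵀ＠⇒⊠⊥th T S U
     (proj₂ (𝐓⊆𝐒⊥th⊥th S S∈𝐓) (T ᵀ＠ U) (ᵀ＠-∈⊥th A B T T∈𝐔 𝐒 T＠𝐒⊆𝐓 U U∈𝐓⊥)))
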